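{- Let $n\ge 2$. For $v\in\mathbb{F}_q^n$ let $M_v$ be the $n\times\binom n2$ matrix over $\mathbb{F}_q$ whose $j$-th row is $X_{v,e_j}$ ($j=1,\dots,n$). If $u,v\in\mathbb{F}_q^n$ satisfy $M_u=M_v$, then $u=v$.
   Context: $e_j$ is the $j$-th unit vector of $\mathbb{F}_q^n$. For $v,u\in\mathbb{F}_q^n$, $X_{v,u}\in\mathbb{F}_q^{\binom n2}$ is the vector whose coordinate indexed by the $2$-subset $\{s,t\}$, $s<t$, of $\{1,\dots,n\}$ is $v_su_t-v_tu_s$. -}

module Defs where

open import Level using (Level; _⊔_)
open import Algebra.Bundles using (CommutativeRing)
open import Data.Nat using (ℕ)
open import Data.Fin using (Fin; _<_; _≟_)
open import Data.Product using (Σ; _×_; _,_; ∃)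
open import Data.List using (List)
open import Data.List.Relation.Unary.Any using (Any)
open import Relation.Nullary using (¬_; yes; no)

record IsField {c ℓ : Level} (R : CommutativeRing c ℓ) : Set (c ⊔ ℓ) where
  open CommutativeRing R
  field
    0≉1     : ¬ (0# ≈ 1#)
    inverse : ∀ x → ¬ (x ≈ 0#) → ∃ λ y → (x * y) ≈ 1#

IsFinite : {c ℓ : Level} (R : CommutativeRing c ℓ) → Set (c ⊔ ℓ)
IsFinite R = Σ (List Carrier) λ xs → ∀ x → Any (x ≈_) xs
  where open CommutativeRing R

module _ {c ℓ : Level} (R : CommutativeRing c ℓ) where
  open CommutativeRing R

  Vec : ℕ → Set c
  Vec n = Fin n → Carrier

  TwoSubset : ℕ → Set
  TwoSubset n = Σ (Fin n × Fin n) λ { (s , t) → s < t }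

  e : {n : ℕ} → Fin n → Vec n
  e j k with j ≟ k
  ... | yes _ = 1#
  ... | no  _ = 0#

  X : {n : ℕ} → Vec n → Vec n → TwoSubset n → Carrier
  X v u ((s , t) , _) = (v s * u t) - (v t * u s)

  M : {n : ℕ} → Vec n → Fin n → TwoSubset n → Carrier
  M v j = X v (e j)

-- Row t of M_v has entry v_s at column {s,t} and row s has entry -v_t there,
-- so once n ≥ 2 every coordinate of v can be read off M_v.
module Submission where

open import Defs
open import Level using (Level)
open import Algebra.Bundles using (CommutativeRing)
open import Data.Nat using (ℕ; _≥_; s≤s; z≤n)
open import Data.Fin using (Fin; zero; suc; _<_; _≟_)
open import Data.Fin.Properties using (<-cmp; <⇒≢)
open import Data.Product using (∃; _,_; proj₂)
open import Relation.Binary.Definitions using (tri<; tri≈; tri>)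
open import Relation.Binary.PropositionalEquality using (_≢_; ≢-sym) renaming (refl to ≡-refl)
open import Relation.Nullary using (yes; no; contradiction)
import Algebra.Properties.Ring as RingProperties

∃-≢ : {n : ℕ} → n ≥ 2 → (i : Fin n) → ∃ (i ≢_)
∃-≢ (s≤s (s≤s z≤n)) zero    = suc zero , λ ()
∃-≢ (s≤s (s≤s z≤n)) (suc i) = zero , λ ()

module _ {c ℓ : Level} (F : CommutativeRing c ℓ) where
  open CommutativeRing F hiding (zero)
  open RingProperties ring using (-0#≈0#; -‿injective)
  open import Relation.Binary.Reasoning.Setoid setoid

  e-diagonal : {n : ℕ} (j : Fin n) → e F j j ≈ 1#
  e-diagonal j with j ≟ j
  ... | yes _   = refl
  ... | no  j≢j = contradiction ≡-refl j≢j

  e-offDiagonal : {n : ℕ} {j k : Fin n} → j ≢ k → e F j k ≈ 0#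
  e-offDiagonal {j = j} {k} j≢k with j ≟ k
  ... | yes j≡k = contradiction j≡k j≢k
  ... | no  _   = refl

  X-unit-upper : {n : ℕ} (v : Vec F n) {s t : Fin n} (s<t : s < t) →
                 X F v (e F t) ((s , t) , s<t) ≈ v s
  X-unit-upper v {s} {t} s<t = begin
    v s * e F t t - v t * e F t s ≈⟨ +-cong (*-congˡ (e-diagonal t))
                                           (-‿cong (*-congˡ (e-offDiagonal (≢-sym (<⇒≢ s<t))))) ⟩
    v s * 1# - v t * 0#           ≈⟨ +-cong (*-identityʳ (v s)) (-‿cong (zeroʳ (v t))) ⟩
    v s - 0#                      ≈⟨ +-congˡ -0#≈0# ⟩
    v s + 0#                      ≈⟨ +-identityʳ (v s) ⟩
    v s                           ∎

  X-unit-lower : {n : ℕ} (v : Vec F n) {s t : Fin n} (s<t : s < t) →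
                 X F v (e F s) ((s , t) , s<t) ≈ - v t
  X-unit-lower v {s} {t} s<t = begin
    v s * e F s t - v t * e F s s ≈⟨ +-cong (*-congˡ (e-offDiagonal (<⇒≢ s<t)))
                                           (-‿cong (*-congˡ (e-diagonal s))) ⟩
    v s * 0# - v t * 1#           ≈⟨ +-cong (zeroʳ (v s)) (-‿cong (*-identityʳ (v t))) ⟩
    0# - v t                      ≈⟨ +-identityˡ (- v t) ⟩
    - v t                         ∎

  M-injective-at : {n : ℕ} (u v : Vec F n) →
                   (∀ j p → M F u j p ≈ M F v j p) →
                   {i k : Fin n} → i ≢ k → u i ≈ v i
  M-injective-at u v M≈ {i} {k} i≢k with <-cmp i k
  ... | tri< i<k _ _ = begin
    u i                     ≈⟨ X-unit-upper u i<k ⟨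
    M F u k ((i , k) , i<k) ≈⟨ M≈ k ((i , k) , i<k) ⟩
    M F v k ((i , k) , i<k) ≈⟨ X-unit-upper v i<k ⟩
    v i                     ∎
  ... | tri≈ _ i≡k _ = contradiction i≡k i≢k
  ... | tri> _ _ k<i = -‿injective (begin
    - u i                   ≈⟨ X-unit-lower u k<i ⟨
    M F u k ((k , i) , k<i) ≈⟨ M≈ k ((k , i) , k<i) ⟩
    M F v k ((k , i) , k<i) ≈⟨ X-unit-lower v k<i ⟩
    - v i                   ∎)

lemma7 : {c ℓ : Level} (F : CommutativeRing c ℓ) → IsField F → IsFinite F →
         (n : ℕ) → n ≥ 2 → (u v : Vec F n) →
         (∀ (j : Fin n) (p : TwoSubset F n) → CommutativeRing._≈_ F (M F u j p) (M F v j p)) →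
         ∀ (i : Fin n) → CommutativeRing._≈_ F (u i) (v i)
lemma7 F _ _ n n≥2 u v M≈ i = M-injective-at F u v M≈ (proj₂ (∃-≢ n≥2 i))
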